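{- Let $n=p_1^{n_1}p_2^{n_2}\cdots p_r^{n_r}$, where $r\geq 2$, $n_1,\ldots,n_r$ are positive integers and $p_1,\ldots,p_r$ are distinct primes with $p_1<p_2<\cdots<p_r$, and let $0\leq k\leq n_r-1$. For $0\leq j\leq n_r-1$ put $\alpha_j=p_1^{n_1}\cdots p_{r-1}^{n_{r-1}}p_r^{j}$, and for $1\leq i\leq r-1$ put $\beta_{k,i}=\alpha_k/p_i$. Define $$Z(r,k)=E_{\alpha_{k+1}}\cup\cdots\cup E_{\alpha_{n_r-1}}\cup E_n\cup S_{\beta_{k,1}}\cup\cdots\cup S_{\beta_{k,r-1}}\subseteq C_n.$$ Then $$|Z(r,k)|=\phi(n)+p_1^{n_1-1}\cdots p_{r-1}^{n_{r-1}-1}\left[p_r^{n_r-1}\phi(p_1\cdots p_{r-1})+p_r^{k}\left[p_1\cdots p_{r-1}-2\phi(p_1\cdots p_{r-1})\right]\right].$$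
   Context: $C_n$ is the cyclic group of order $n$ and $\phi$ is Euler's totient function. For a positive divisor $d$ of $n$, $E_d$ is the set of elements of $C_n$ of order exactly $d$, and $S_d$ is the set of elements of $C_n$ whose order divides $d$. When $k=n_r-1$, the union $E_{\alpha_{k+1}}\cup\cdots\cup E_{\alpha_{n_r-1}}$ is empty. -}

module Defs where

open import Data.Nat using (ℕ; zero; suc; _+_; _*_; _∸_; _^_; _≤_; _<_; NonZero)
open import Data.Nat.Divisibility using (_∣_; _∣?_)
open import Data.Nat.GCD using (gcd)
open import Data.Nat.Primality using (Prime; prime⇒nonZero)
open import Data.Nat.Properties using (_≟_)
open import Data.Fin as Fin using (Fin; toℕ; fromℕ; inject₁)
open import Data.List using (List; []; _∷_; length; filter; upTo; allFin; map)
open import Data.List.Relation.Unary.Any using (Any; any?)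
open import Data.Sum using (_⊎_)
open import Data.Product using (_×_)
open import Relation.Nullary using (Dec; yes; no)
open import Relation.Nullary.Decidable using (_⊎-dec_; _×-dec_)
open import Relation.Binary.PropositionalEquality using (_≡_)

∏ : ∀ {k} → (Fin k → ℕ) → ℕ
∏ {zero}  f = 1
∏ {suc k} f = f Fin.zero * ∏ (λ i → f (Fin.suc i))

φ : ℕ → ℕ
φ m = length (filter (λ d → gcd (suc d) m ≟ 1) (upTo m))

-- The cyclic group C_n is modelled as Fin n = {0,…,n-1} under addition
-- mod n.  For x ∈ C_n and d ∈ ℕ, d·x = 0 in C_n  iff  n ∣ d * toℕ x.
-- The order of x is the least d ≥ 1 with d·x = 0.  It is computed by
-- searching d = 1, 2, … , n (d = n always works).
searchOrd : (n a d fuel : ℕ) → ℕ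
searchOrd n a d zero = d
searchOrd n a d (suc fuel) with n ∣? (d * a)
... | yes _ = d
... | no  _ = searchOrd n a (suc d) fuel

ord : ∀ {n} → Fin n → ℕ
ord {n} x = searchOrd n (toℕ x) 1 n

E : ∀ {n} → ℕ → Fin n → Set
E d x = ord x ≡ d

S : ∀ {n} → ℕ → Fin n → Set
S d x = ord x ∣ d

-- Parameters:  n = p₁^{n₁} ⋯ p_r^{n_r}  with r = suc m ≥ 2.
-- Primes are indexed by Fin (suc m); index (inject₁ i), i : Fin m, is
-- p_{i+1} (1 ≤ i+1 ≤ r-1) and index (fromℕ m) is p_r.
record Params : Set where
  field
    m      : ℕ
    r≥2    : 1 ≤ m
    p      : Fin (suc m) → ℕ
    e      : Fin (suc m) → ℕ
    prime  : ∀ i → Prime (p i)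
    p-incr : ∀ i j → i Fin.< j → p i < p j
    e-pos  : ∀ i → 1 ≤ e i

module _ (P : Params) where
  open Params P

  r : ℕ
  r = suc m

  pr : ℕ
  pr = p (fromℕ m)

  nr : ℕ
  nr = e (fromℕ m)

  A : ℕ
  A = ∏ (λ (i : Fin m) → p (inject₁ i) ^ e (inject₁ i))

  N : ℕ
  N = A * pr ^ nr

  α : ℕ → ℕ
  α j = A * pr ^ j

  -- β_{k,i} = α_k / p_i   (i : Fin m stands for the index i+1 ∈ {1,…,r-1})
  β : ℕ → Fin m → ℕ
  β k i = Data.Nat._/_ (α k) (p (inject₁ i)) {{prime⇒nonZero (prime (inject₁ i))}}

  range : ℕ → List ℕ
  range k = map (λ t → suc k + t) (upTo (nr ∸ suc k))

  InZ : ℕ → Fin N → Set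
  InZ k x = Any (λ j → E (α j) x) (range k)
          ⊎ (E N x
          ⊎ Any (λ i → S (β k i) x) (allFin m))

  InZ? : ∀ k (x : Fin N) → Dec (InZ k x)
  InZ? k x = any? (λ j → ord x ≟ α j) (range k)
           ⊎-dec ((ord x ≟ N)
           ⊎-dec any? (λ i → ord x ∣? β k i) (allFin m))

  cardZ : ℕ → ℕ
  cardZ k = length (filter (InZ? k) (allFin N))

  A′ : ℕ
  A′ = ∏ (λ (i : Fin m) → p (inject₁ i) ^ (e (inject₁ i) ∸ 1))

  Q : ℕ
  Q = ∏ (λ (i : Fin m) → p (inject₁ i))

module Submission where

-- Identify C_n with {0, …, n − 1} and write n = a·q^{n_r} with q = p_r and
-- a = p₁^{n₁}⋯p_{r−1}^{n_{r−1}}; put s = n_r − k. The order of y is n / gcd(n, y), so y has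
-- order α_j for some k < j ≤ n_r (where α_{n_r} = n) iff y is prime to a and q^s ∤ y, while
-- the order of y divides some β_{k,i} iff p_i·q^s ∣ y for some i, i.e. iff q^s ∣ y and y is
-- not prime to a. These two sets are disjoint, and counting residues prime to a and
-- multiples of q^s gives their sizes q^{n_r}φ(a) − q^kφ(a) and a·q^k − q^kφ(a). With
-- φ(n) = q^{n_r}φ(a) − q^{n_r−1}φ(a), φ(a) = A′φ(Q) and a = A′Q this is the formula.

open import Defs

-- A separate module, so that ℕ's arithmetic operators stay out of scope of the final
-- statement, which is about ℤ.
module Arithmetic where

  open import Level using (0ℓ)
  open import Algebra.Properties.CommutativeSemigroup using (interchange)
  open import Data.Bool.Base using (true; false; if_then_else_)
  open import Data.Fin.Base as Fin using (Fin; toℕ; fromℕ; inject₁)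
  open import Data.Fin.Properties using (toℕ-inject₁; toℕ-fromℕ; toℕ<n; ¬∀⟶∃¬)
  open import Data.List.Base using (_∷_; length; filter; tabulate; applyUpTo; allFin)
  open import Data.List.Relation.Unary.Any using (Any)
  open import Data.List.Membership.Propositional using (_∈_; find; lose)
  open import Data.List.Membership.Propositional.Properties
    using (∈-allFin; ∈-upTo⁺; ∈-upTo⁻; ∈-map⁺; ∈-map⁻)
  open import Data.Nat.Base
  open import Data.Nat.Properties
  open import Data.Nat.Tactic.RingSolver using (solve-∀)
  open import Data.Nat.Divisibility
  open import Data.Nat.Coprimality as Coprimality
    using (Coprime; coprime?; coprime-divisor; 1-coprimeTo; coprime-+; 0-coprimeTo-m⇒m≡1;
           gcd≡1⇒coprime; coprime⇒gcd≡1)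
  open import Data.Nat.Primality
    using (Prime; prime⇒irreducible; prime⇒nonTrivial; prime⇒nonZero; euclidsLemma)
  open import Data.Nat.GCD using (gcd)
  open import Data.Nat.DivMod using (_/_; _%_; m≡m%n+[m/n]*n; m%n<n; m/n*n≡m)
  open import Data.Product.Base using (_×_; _,_; proj₁; proj₂; ∃; ∃-syntax; swap)
  open import Data.Sum.Base using (_⊎_; inj₁; inj₂; [_,_]; map₂; assocˡ; assocʳ)
  open import Data.Sum.Function.Propositional using (_⊎-⇔_)
  open import Function.Base using (_∘_; id)
  open import Function.Bundles using (_⇔_; mk⇔; Equivalence)
  open import Function.Properties.Equivalence using () renaming (trans to ⇔-trans)
  open import Relation.Nullary.Decidable
    using (Dec; yes; no; does; does-⇔; dec-false; _⊎-dec_; _×-dec_; ¬?; decidable-stable; toSum)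
  open import Relation.Nullary.Negation using (¬_; contradiction)
  open import Relation.Unary using (Pred; Decidable; _∩_; _∪_; ∁)
  open import Relation.Unary.Properties using (U?; _∩?_; _∪?_; ∁?)
  open import Relation.Binary.PropositionalEquality hiding ([_])

  open Equivalence using (to; from)

  +-interchange : ∀ a b c d → (a + b) + (c + d) ≡ (a + c) + (b + d)
  +-interchange = interchange +-commutativeSemigroup

  *-interchange : ∀ a b c d → (a * b) * (c * d) ≡ (a * c) * (b * d)
  *-interchange = interchange *-commutativeSemigroup

  -- Counting

  indicator : ∀ {A : Set} → Dec A → ℕ
  indicator a? = if does a? then 1 else 0

  indicator-⇔ : ∀ {A B : Set} → A ⇔ B → (a? : Dec A) (b? : Dec B) → indicator a? ≡ indicator b?
  indicator-⇔ A⇔B a? b? = cong (if_then 1 else 0) (does-⇔ A⇔B a? b?)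

  count : {P : Pred ℕ 0ℓ} → Decidable P → ℕ → ℕ
  count P? zero    = 0
  count P? (suc n) = indicator (P? 0) + count (P? ∘ suc) n

  indicator-⊎ : ∀ {A B : Set} (a? : Dec A) (b? : Dec B) → (A → ¬ B) →
    indicator (a? ⊎-dec b?) ≡ indicator a? + indicator b?
  indicator-⊎ (yes a) (yes b) disjoint = contradiction b (disjoint a)
  indicator-⊎ (yes a) (no ¬b) disjoint = refl
  indicator-⊎ (no ¬a) (yes b) disjoint = refl
  indicator-⊎ (no ¬a) (no ¬b) disjoint = refl

  count-cong : ∀ {P R : Pred ℕ 0ℓ} (P? : Decidable P) (R? : Decidable R) →
    (∀ y → P y ⇔ R y) → ∀ n → count P? n ≡ count R? n
  count-cong P? R? P⇔R zero    = refl
  count-cong P? R? P⇔R (suc n) =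
    cong₂ _+_ (indicator-⇔ (P⇔R 0) (P? 0) (R? 0))
              (count-cong (P? ∘ suc) (R? ∘ suc) (P⇔R ∘ suc) n)

  count-∪ : ∀ {P R : Pred ℕ 0ℓ} (P? : Decidable P) (R? : Decidable R) →
    (∀ y → P y → ¬ R y) → ∀ n → count (P? ∪? R?) n ≡ count P? n + count R? n
  count-∪ P? R? disjoint zero    = refl
  count-∪ P? R? disjoint (suc n) = trans
    (cong₂ _+_ (indicator-⊎ (P? 0) (R? 0) (disjoint 0))
               (count-∪ (P? ∘ suc) (R? ∘ suc) (disjoint ∘ suc) n))
    (+-interchange (indicator (P? 0)) (indicator (R? 0)) _ _)

  count-partition : ∀ {P R : Pred ℕ 0ℓ} (P? : Decidable P) (R? : Decidable R) →
    ∀ n → count P? n ≡ count (P? ∩? R?) n + count (P? ∩? ∁? R?) n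
  count-partition {P} {R} P? R? n = trans
    (count-cong P? ((P? ∩? R?) ∪? (P? ∩? ∁? R?)) split n)
    (count-∪ (P? ∩? R?) (P? ∩? ∁? R?) (λ _ (_ , r) (_ , ¬r) → ¬r r) n)
    where
    split : ∀ y → P y ⇔ ((P ∩ R) ∪ (P ∩ ∁ R)) y
    split y = mk⇔ (λ p → [ (λ r → inj₁ (p , r)) , (λ ¬r → inj₂ (p , ¬r)) ] (toSum (R? y)))
                  [ proj₁ , proj₁ ]

  count-∘-cong : ∀ {P : Pred ℕ 0ℓ} (P? : Decidable P) {f g : ℕ → ℕ} →
    (∀ y → f y ≡ g y) → ∀ n → count (P? ∘ f) n ≡ count (P? ∘ g) n
  count-∘-cong P? f≗g zero    = refl
  count-∘-cong P? f≗g (suc n) =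
    cong₂ _+_ (cong (λ z → indicator (P? z)) (f≗g 0)) (count-∘-cong P? (f≗g ∘ suc) n)

  count-+ : ∀ {P : Pred ℕ 0ℓ} (P? : Decidable P) m n →
    count P? (m + n) ≡ count P? m + count (P? ∘ (m +_)) n
  count-+ P? zero    n = refl
  count-+ P? (suc m) n =
    trans (cong (indicator (P? 0) +_) (count-+ (P? ∘ suc) m n))
          (sym (+-assoc (indicator (P? 0)) _ _))

  count-U : ∀ n → count (U? {A = ℕ}) n ≡ n
  count-U zero    = refl
  count-U (suc n) = cong suc (count-U n)

  count-none : ∀ {P : Pred ℕ 0ℓ} (P? : Decidable P) n → (∀ y → y < n → ¬ P y) → count P? n ≡ 0
  count-none P? zero    none = refl
  count-none P? (suc n) none = cong₂ _+_
    (cong (if_then 1 else 0) (dec-false (P? 0) (none 0 z<s)))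
    (count-none (P? ∘ suc) n (λ y y<n → none (suc y) (s<s y<n)))

  count-rotate : ∀ {P : Pred ℕ 0ℓ} (P? : Decidable P) n → P n ⇔ P 0 →
    count (P? ∘ suc) n ≡ count P? n
  count-rotate P? n Pn⇔P0 = +-cancelˡ-≡ (indicator (P? 0)) _ _ (begin
    count P? (1 + n)                          ≡⟨ cong (count P?) (+-comm 1 n) ⟩
    count P? (n + 1)                          ≡⟨ count-+ P? n 1 ⟩
    count P? n + (indicator (P? (n + 0)) + 0) ≡⟨ cong (count P? n +_) last ⟩
    count P? n + indicator (P? 0)             ≡⟨ +-comm (count P? n) _ ⟩
    indicator (P? 0) + count P? n             ∎)
    where
    open ≡-Reasoning
    last : indicator (P? (n + 0)) + 0 ≡ indicator (P? 0)
    last = trans (+-identityʳ _)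
      (trans (cong (λ z → indicator (P? z)) (+-identityʳ n)) (indicator-⇔ Pn⇔P0 (P? n) (P? 0)))

  count-periodic : ∀ {P : Pred ℕ 0ℓ} (P? : Decidable P) M →
    (∀ y → P (M + y) ⇔ P y) → ∀ c → count P? (c * M) ≡ c * count P? M
  count-periodic P? M periodic zero    = refl
  count-periodic P? M periodic (suc c) = begin
    count P? (M + c * M)                            ≡⟨ count-+ P? M (c * M) ⟩
    count P? M + count (P? ∘ (M +_)) (c * M)
      ≡⟨ cong (count P? M +_) (count-cong _ P? periodic (c * M)) ⟩
    count P? M + count P? (c * M)
      ≡⟨ cong (count P? M +_) (count-periodic P? M periodic c) ⟩
    count P? M + c * count P? M ∎
    where open ≡-Reasoning

  count-multiples : ∀ {R : Pred ℕ 0ℓ} (R? : Decidable R) d .{{_ : NonZero d}} K →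
    count ((d ∣?_) ∩? R?) (K * d) ≡ count (R? ∘ (d *_)) K
  count-multiples R? d zero    = refl
  count-multiples {R} R? d@(suc d′) (suc K) = begin
    count ((d ∣?_) ∩? R?) (d + K * d)
      ≡⟨ count-+ ((d ∣?_) ∩? R?) d (K * d) ⟩
    count ((d ∣?_) ∩? R?) d + count (((d ∣?_) ∩? R?) ∘ (d +_)) (K * d)
      ≡⟨ cong₂ _+_ firstPeriod (count-cong _ ((d ∣?_) ∩? (R? ∘ (d +_))) shift (K * d)) ⟩
    indicator (R? (d * 0)) + count ((d ∣?_) ∩? (R? ∘ (d +_))) (K * d)
      ≡⟨ cong (indicator (R? (d * 0)) +_) (count-multiples (R? ∘ (d +_)) d K) ⟩
    indicator (R? (d * 0)) + count (R? ∘ (d +_) ∘ (d *_)) K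
      ≡⟨ cong (indicator (R? (d * 0)) +_) (count-∘-cong R? (λ z → sym (*-suc d z)) K) ⟩
    count (R? ∘ (d *_)) (suc K) ∎
    where
    open ≡-Reasoning
    shift : ∀ y → (d ∣ d + y × R (d + y)) ⇔ (d ∣ y × R (d + y))
    shift y = mk⇔ (λ (d∣ , r) → ∣m+n∣m⇒∣n d∣ ∣-refl , r)
                  (λ (d∣ , r) → ∣m∣n⇒∣m+n ∣-refl d∣ , r)
    firstPeriod : count ((d ∣?_) ∩? R?) d ≡ indicator (R? (d * 0))
    firstPeriod = begin
      indicator (d ∣? 0 ×-dec R? 0) + count (((d ∣?_) ∩? R?) ∘ suc) d′
        ≡⟨ cong₂ _+_ (indicator-⇔ (mk⇔ proj₂ (d ∣0 ,_)) (d ∣? 0 ×-dec R? 0) (R? 0))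
                     (count-none _ d′ (λ y y<d′ (d∣ , _) → <⇒≱ (s<s y<d′) (∣⇒≤ d∣))) ⟩
      indicator (R? 0) + 0
        ≡⟨ trans (+-identityʳ _) (cong (λ z → indicator (R? z)) (sym (*-zeroʳ d))) ⟩
      indicator (R? (d * 0)) ∎

  count-divisible : ∀ d .{{_ : NonZero d}} K → count (d ∣?_) (K * d) ≡ K
  count-divisible d K = begin
    count (d ∣?_) (K * d)              ≡⟨ count-cong _ ((d ∣?_) ∩? U?) (λ _ → mk⇔ (_, _) proj₁) (K * d) ⟩
    count ((d ∣?_) ∩? U?) (K * d)      ≡⟨ count-multiples U? d K ⟩
    count (U? ∘ (d *_)) K              ≡⟨ count-U K ⟩
    K                                  ∎
    where open ≡-Reasoning

  count-∩-comm : ∀ {P R : Pred ℕ 0ℓ} (P? : Decidable P) (R? : Decidable R) →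
    ∀ n → count (P? ∩? R?) n ≡ count (R? ∩? P?) n
  count-∩-comm P? R? = count-cong (P? ∩? R?) (R? ∩? P?) (λ _ → mk⇔ swap swap)

  length-filter-∷ : ∀ {A : Set} {P : Pred A 0ℓ} (P? : Decidable P) x xs →
    length (filter P? (x ∷ xs)) ≡ indicator (P? x) + length (filter P? xs)
  length-filter-∷ P? x xs with does (P? x)
  ... | true  = refl
  ... | false = refl

  length-filter-applyUpTo : ∀ {A : Set} {P : Pred A 0ℓ} (P? : Decidable P) (f : ℕ → A) n →
    length (filter P? (applyUpTo f n)) ≡ count (P? ∘ f) n
  length-filter-applyUpTo P? f zero    = refl
  length-filter-applyUpTo P? f (suc n) = trans (length-filter-∷ P? (f 0) _)
    (cong (indicator (P? (f 0)) +_) (length-filter-applyUpTo P? (f ∘ suc) n))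

  length-filter-tabulate : ∀ {A : Set} {P : Pred A 0ℓ} {R : Pred ℕ 0ℓ}
    (P? : Decidable P) (R? : Decidable R) {n} (f : Fin n → A) →
    (∀ i → P (f i) ⇔ R (toℕ i)) → length (filter P? (tabulate f)) ≡ count R? n
  length-filter-tabulate P? R? {zero}  f P⇔R = refl
  length-filter-tabulate P? R? {suc n} f P⇔R = trans (length-filter-∷ P? (f Fin.zero) _)
    (cong₂ _+_ (indicator-⇔ (P⇔R Fin.zero) (P? (f Fin.zero)) (R? 0))
               (length-filter-tabulate P? (R? ∘ suc) (f ∘ Fin.suc) (P⇔R ∘ Fin.suc)))

  -- The additive order in ℤ/Nℤ

  searchOrd-≥ : ∀ n a d fuel → d ≤ searchOrd n a d fuel
  searchOrd-≥ n a d zero = ≤-refl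
  searchOrd-≥ n a d (suc fuel) with n ∣? (d * a)
  ... | yes _ = ≤-refl
  ... | no  _ = ≤-trans (n≤1+n d) (searchOrd-≥ n a (suc d) fuel)

  searchOrd-found : ∀ n a d fuel →
    n ∣ searchOrd n a d fuel * a ⊎ searchOrd n a d fuel ≡ d + fuel
  searchOrd-found n a d zero = inj₂ (sym (+-identityʳ d))
  searchOrd-found n a d (suc fuel) with n ∣? (d * a)
  ... | yes n∣ = inj₁ n∣
  ... | no  _  = map₂ (λ eq → trans eq (sym (+-suc d fuel))) (searchOrd-found n a (suc d) fuel)

  searchOrd-minimal : ∀ n a d fuel {d′} → d ≤ d′ → d′ < searchOrd n a d fuel → ¬ n ∣ d′ * a
  searchOrd-minimal n a d zero d≤d′ d′<d = contradiction d≤d′ (<⇒≱ d′<d)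
  searchOrd-minimal n a d (suc fuel) {d′} d≤d′ d′<o with n ∣? (d * a)
  ... | yes _ = contradiction d≤d′ (<⇒≱ d′<o)
  ... | no n∤ with m≤n⇒m<n∨m≡n d≤d′
  ...   | inj₁ d<d′ = searchOrd-minimal n a (suc d) fuel d<d′ d′<o
  ...   | inj₂ refl = n∤

  IsAdditiveOrder : ℕ → ℕ → ℕ → Set
  IsAdditiveOrder N y o = ∀ d → o ∣ d ⇔ N ∣ d * y

  least-annihilator-isAdditiveOrder : ∀ {N y o} .{{_ : NonZero o}} → N ∣ o * y →
    (∀ d → 1 ≤ d → d < o → ¬ N ∣ d * y) → IsAdditiveOrder N y o
  least-annihilator-isAdditiveOrder {N} {y} {o} N∣oy least d = mk⇔ annihilates divides-order
    where
    annihilates : o ∣ d → N ∣ d * y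
    annihilates (divides c refl) = subst (N ∣_) (sym (*-assoc c o y)) (∣n⇒∣m*n c N∣oy)
    divides-order : N ∣ d * y → o ∣ d
    divides-order N∣dy with d % o in eq
    ... | zero  = m%n≡0⇒n∣m d o eq
    ... | suc r = contradiction N∣ry (least (suc r) (s≤s z≤n) (subst (_< o) eq (m%n<n d o)))
      where
      split : d * y ≡ (d / o) * (o * y) + suc r * y
      split = begin
        d * y                         ≡⟨ cong (_* y) (m≡m%n+[m/n]*n d o) ⟩
        (d % o + d / o * o) * y       ≡⟨ *-distribʳ-+ y (d % o) (d / o * o) ⟩
        d % o * y + d / o * o * y     ≡⟨ cong₂ _+_ (cong (_* y) eq) (*-assoc (d / o) o y) ⟩
        suc r * y + d / o * (o * y)   ≡⟨ +-comm (suc r * y) _ ⟩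
        d / o * (o * y) + suc r * y   ∎
        where open ≡-Reasoning
      N∣ry : N ∣ suc r * y
      N∣ry = ∣m+n∣m⇒∣n (subst (N ∣_) split N∣dy) (∣n⇒∣m*n (d / o) N∣oy)

  ord-isAdditiveOrder : ∀ {N} (x : Fin N) → IsAdditiveOrder N (toℕ x) (ord x)
  ord-isAdditiveOrder {N@(suc _)} x =
    least-annihilator-isAdditiveOrder {{>-nonZero (searchOrd-≥ N (toℕ x) 1 N)}} annihilates
      (λ d 1≤d → searchOrd-minimal N (toℕ x) 1 N 1≤d)
    where
    annihilates : N ∣ ord x * toℕ x
    annihilates with searchOrd-found N (toℕ x) 1 N
    ... | inj₁ N∣ = N∣
    ... | inj₂ o≡1+N = contradiction (m∣m*n (toℕ x))
          (searchOrd-minimal N (toℕ x) 1 N (s≤s z≤n) (subst (N <_) (sym o≡1+N) ≤-refl))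

  order∣factor⇔cofactor∣ : ∀ {c m y o} .{{_ : NonZero c}} →
    IsAdditiveOrder (c * m) y o → o ∣ c ⇔ m ∣ y
  order∣factor⇔cofactor∣ {c} order =
    mk⇔ (λ o∣c → *-cancelˡ-∣ c (to (order c) o∣c)) (λ m∣y → from (order c) (*-monoʳ-∣ c m∣y))

  -- Coprimality

  coprime-* : ∀ {a b y} → Coprime a y → Coprime b y → Coprime (a * b) y
  coprime-* {a} {b} {y} a⊥y b⊥y {d} (d∣ab , d∣y) = b⊥y (coprime-divisor d⊥a d∣ab , d∣y)
    where
    d⊥a : Coprime d a
    d⊥a (e∣d , e∣a) = a⊥y (e∣a , ∣-trans e∣d d∣y)

  coprime-^ : ∀ {a y} → Coprime a y → ∀ j → Coprime (a ^ j) y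
  coprime-^ {y = y} a⊥y zero    = 1-coprimeTo y
  coprime-^         a⊥y (suc j) = coprime-* a⊥y (coprime-^ a⊥y j)

  coprime-∏ : ∀ {k} (f : Fin k → ℕ) {y} → (∀ i → Coprime (f i) y) → Coprime (∏ f) y
  coprime-∏ {zero}  f {y} _   = 1-coprimeTo y
  coprime-∏ {suc k} f     f⊥y = coprime-* (f⊥y Fin.zero) (coprime-∏ (f ∘ Fin.suc) (f⊥y ∘ Fin.suc))

  coprime-∣* : ∀ {a b c} → Coprime a b → a ∣ c → b ∣ c → a * b ∣ c
  coprime-∣* {a} {b} a⊥b (divides u refl) b∣ua
    with coprime-divisor (Coprimality.sym a⊥b) (subst (b ∣_) (*-comm u a) b∣ua)
  ... | divides w refl = divides w (trans (*-assoc w b a) (cong (w *_) (*-comm b a)))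

  prime∤⇒coprime : ∀ {p y} → Prime p → ¬ p ∣ y → Coprime p y
  prime∤⇒coprime p-prime p∤y (d∣p , d∣y) with prime⇒irreducible p-prime d∣p
  ... | inj₁ d≡1 = d≡1
  ... | inj₂ refl = contradiction d∣y p∤y

  prime∣∧∣⇒¬coprime : ∀ {p y b} → Prime p → p ∣ y → p ∣ b → ¬ Coprime y b
  prime∣∧∣⇒¬coprime p-prime p∣y p∣b y⊥b =
    nonTrivial⇒≢1 {{prime⇒nonTrivial p-prime}} (y⊥b (p∣y , p∣b))

  prime∤prime : ∀ {p q} → Prime p → Prime q → p ≢ q → ¬ p ∣ q
  prime∤prime p-prime q-prime p≢q p∣q with prime⇒irreducible q-prime p∣q
  ... | inj₁ p≡1 = nonTrivial⇒≢1 {{prime⇒nonTrivial p-prime}} p≡1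
  ... | inj₂ p≡q = p≢q p≡q

  prime∣^⇒∣ : ∀ {p q} → Prime p → ∀ j → p ∣ q ^ j → p ∣ q
  prime∣^⇒∣ p-prime zero p∣1 = contradiction (∣1⇒≡1 p∣1) (nonTrivial⇒≢1 {{prime⇒nonTrivial p-prime}})
  prime∣^⇒∣ {q = q} p-prime (suc j) p∣qʲ⁺¹ with euclidsLemma q (q ^ j) p-prime p∣qʲ⁺¹
  ... | inj₁ p∣q  = p∣q
  ... | inj₂ p∣qʲ = prime∣^⇒∣ p-prime j p∣qʲ

  m∣m^n : ∀ m {n} → 1 ≤ n → m ∣ m ^ n
  m∣m^n m {suc n} _ = m∣m*n (m ^ n)

  m^[n∸1]*m≡m^n : ∀ m {n} → 1 ≤ n → m ^ (n ∸ 1) * m ≡ m ^ n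
  m^[n∸1]*m≡m^n m {suc n} _ = *-comm (m ^ n) m

  coprime-∣ : ∀ {x b d} → Coprime x b → d ∣ b → Coprime x d
  coprime-∣ x⊥b d∣b (e∣x , e∣d) = x⊥b (e∣x , ∣-trans e∣d d∣b)

  ∤-power⇒exact-power : ∀ d y s → ¬ d ^ s ∣ y → ∃[ t ] (t < s × d ^ t ∣ y × ¬ d ^ suc t ∣ y)
  ∤-power⇒exact-power d y zero    d⁰∤y = contradiction (1∣ y) d⁰∤y
  ∤-power⇒exact-power d y (suc s) dˢ⁺¹∤y with d ^ s ∣? y
  ... | yes dˢ∣y = s , ≤-refl , dˢ∣y , dˢ⁺¹∤y
  ... | no  dˢ∤y with ∤-power⇒exact-power d y s dˢ∤y
  ...   | t , t<s , exact = t , m<n⇒m<1+n t<s , exact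

  Any-allFin⇔ : ∀ {n} {P : Pred (Fin n) 0ℓ} → Any P (allFin n) ⇔ ∃ P
  Any-allFin⇔ = mk⇔ (λ any → let (i , _ , Pi) = find any in i , Pi) (λ (i , Pi) → lose (∈-allFin i) Pi)

  ∣∏ : ∀ {k} (f : Fin k → ℕ) i → f i ∣ ∏ f
  ∣∏ f Fin.zero    = m∣m*n _
  ∣∏ f (Fin.suc i) = ∣n⇒∣m*n (f Fin.zero) (∣∏ (f ∘ Fin.suc) i)

  ∏-nonZero : ∀ {k} (f : Fin k → ℕ) → (∀ i → NonZero (f i)) → NonZero (∏ f)
  ∏-nonZero {zero}  f _  = _
  ∏-nonZero {suc k} f nz = m*n≢0 (f Fin.zero) _ {{nz Fin.zero}} {{∏-nonZero (f ∘ Fin.suc) (nz ∘ Fin.suc)}}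

  ∏-* : ∀ {k} (f g : Fin k → ℕ) → ∏ f * ∏ g ≡ ∏ (λ i → f i * g i)
  ∏-* {zero}  f g = refl
  ∏-* {suc k} f g = trans (*-interchange (f Fin.zero) _ (g Fin.zero) _)
    (cong (f Fin.zero * g Fin.zero *_) (∏-* (f ∘ Fin.suc) (g ∘ Fin.suc)))

  ∏-cong : ∀ {k} {f g : Fin k → ℕ} → (∀ i → f i ≡ g i) → ∏ f ≡ ∏ g
  ∏-cong {zero}  f≗g = refl
  ∏-cong {suc k} f≗g = cong₂ _*_ (f≗g Fin.zero) (∏-cong (f≗g ∘ Fin.suc))

  -- Euler's totient

  coprimeTo? : ∀ M → Decidable (λ y → Coprime y M)
  coprimeTo? M y = coprime? y M

  -- φ counts 1, …, M; shifting to 0, …, M − 1 is harmless since Coprime 0 M and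
  -- Coprime M M both mean M ≡ 1.
  φ≡count-coprime : ∀ M → φ M ≡ count (coprimeTo? M) M
  φ≡count-coprime M = begin
    φ M
      ≡⟨ length-filter-applyUpTo (λ d → gcd (suc d) M ≟ 1) id M ⟩
    count (λ d → gcd (suc d) M ≟ 1) M
      ≡⟨ count-cong _ (coprimeTo? M ∘ suc) (λ _ → mk⇔ gcd≡1⇒coprime coprime⇒gcd≡1) M ⟩
    count (coprimeTo? M ∘ suc) M
      ≡⟨ count-rotate (coprimeTo? M) M (mk⇔ M⊥M⇒0⊥M 0⊥M⇒M⊥M) ⟩
    count (coprimeTo? M) M ∎
    where
    open ≡-Reasoning
    M⊥M⇒0⊥M : Coprime M M → Coprime 0 M
    M⊥M⇒0⊥M M⊥M = subst (Coprime 0) (sym (M⊥M (∣-refl , ∣-refl))) (Coprimality.sym (1-coprimeTo 0))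
    0⊥M⇒M⊥M : Coprime 0 M → Coprime M M
    0⊥M⇒M⊥M 0⊥M = subst (λ z → Coprime z z) (sym (0-coprimeTo-m⇒m≡1 0⊥M)) (1-coprimeTo 1)

  count-coprime-multiple : ∀ M c → count (coprimeTo? M) (c * M) ≡ c * φ M
  count-coprime-multiple M c = begin
    count (coprimeTo? M) (c * M)   ≡⟨ count-periodic (coprimeTo? M) M periodic c ⟩
    c * count (coprimeTo? M) M     ≡⟨ cong (c *_) (sym (φ≡count-coprime M)) ⟩
    c * φ M                        ∎
    where
    open ≡-Reasoning
    periodic : ∀ y → Coprime (M + y) M ⇔ Coprime y M
    periodic y = mk⇔ M+y⊥M⇒y⊥M coprime-+
      where
      M+y⊥M⇒y⊥M : Coprime (M + y) M → Coprime y M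
      M+y⊥M⇒y⊥M M+y⊥M (d∣y , d∣M) = M+y⊥M (∣m∣n⇒∣m+n d∣M d∣y , d∣M)

  φ-*-sameRadical : ∀ c b → (∀ y → Coprime y b → Coprime y (c * b)) → φ (c * b) ≡ c * φ b
  φ-*-sameRadical c b ⊥b⇒⊥cb = begin
    φ (c * b)
      ≡⟨ φ≡count-coprime (c * b) ⟩
    count (coprimeTo? (c * b)) (c * b)
      ≡⟨ count-cong _ (coprimeTo? b) (λ y → mk⇔ ⊥cb⇒⊥b (⊥b⇒⊥cb y)) (c * b) ⟩
    count (coprimeTo? b) (c * b)
      ≡⟨ count-coprime-multiple b c ⟩
    c * φ b ∎
    where
    open ≡-Reasoning
    ⊥cb⇒⊥b : ∀ {y} → Coprime y (c * b) → Coprime y b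
    ⊥cb⇒⊥b y⊥cb (d∣y , d∣b) = y⊥cb (d∣y , ∣n⇒∣m*n c d∣b)

  count-multiples-coprime : ∀ d .{{_ : NonZero d}} M c → Coprime d M →
    count ((d ∣?_) ∩? coprimeTo? M) (M * c * d) ≡ c * φ M
  count-multiples-coprime d M c d⊥M = begin
    count ((d ∣?_) ∩? coprimeTo? M) (M * c * d)
      ≡⟨ count-multiples (coprimeTo? M) d (M * c) ⟩
    count (coprimeTo? M ∘ (d *_)) (M * c)
      ≡⟨ count-cong _ (coprimeTo? M) (λ z → mk⇔ dz⊥M⇒z⊥M (coprime-* d⊥M)) (M * c) ⟩
    count (coprimeTo? M) (M * c)
      ≡⟨ cong (count (coprimeTo? M)) (*-comm M c) ⟩
    count (coprimeTo? M) (c * M)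
      ≡⟨ count-coprime-multiple M c ⟩
    c * φ M ∎
    where
    open ≡-Reasoning
    dz⊥M⇒z⊥M : ∀ {z} → Coprime (d * z) M → Coprime z M
    dz⊥M⇒z⊥M dz⊥M (e∣z , e∣M) = dz⊥M (∣n⇒∣m*n d e∣z , e∣M)

  module PrimeFactors (P : Params) where
    open Params P

    q : ℕ
    q = pr P

    a : ℕ
    a = A P

    pᵢ : Fin m → ℕ
    pᵢ i = p (inject₁ i)

    q-prime : Prime q
    q-prime = prime (fromℕ m)

    pᵢ-prime : ∀ i → Prime (pᵢ i)
    pᵢ-prime i = prime (inject₁ i)

    pᵢ≢q : ∀ i → pᵢ i ≢ q
    pᵢ≢q i = <⇒≢ (p-incr (inject₁ i) (fromℕ m)
      (subst₂ _<_ (sym (toℕ-inject₁ i)) (sym (toℕ-fromℕ m)) (toℕ<n i)))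

    instance
      q-nonZero : NonZero q
      q-nonZero = prime⇒nonZero q-prime

      a-nonZero : NonZero a
      a-nonZero = ∏-nonZero _ (λ i → m^n≢0 (pᵢ i) (e (inject₁ i)) {{prime⇒nonZero (pᵢ-prime i)}})

    a*q^j-nonZero : ∀ j → NonZero (a * q ^ j)
    a*q^j-nonZero j = m*n≢0 a (q ^ j) {{a-nonZero}} {{m^n≢0 q j}}

    instance
      N-nonZero : NonZero (N P)
      N-nonZero = a*q^j-nonZero (nr P)

    pᵢ∣a : ∀ i → pᵢ i ∣ a
    pᵢ∣a i = ∣-trans (m∣m^n (pᵢ i) (e-pos (inject₁ i))) (∣∏ (λ i → pᵢ i ^ e (inject₁ i)) i)

    coprime-a⇔ : ∀ y → Coprime y a ⇔ (∀ i → ¬ pᵢ i ∣ y)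
    coprime-a⇔ y = mk⇔ coprime⇒pᵢ∤ pᵢ∤⇒coprime
      where
      coprime⇒pᵢ∤ : Coprime y a → ∀ i → ¬ pᵢ i ∣ y
      coprime⇒pᵢ∤ y⊥a i pᵢ∣y = prime∣∧∣⇒¬coprime (pᵢ-prime i) pᵢ∣y (pᵢ∣a i) y⊥a
      pᵢ∤⇒coprime : (∀ i → ¬ pᵢ i ∣ y) → Coprime y a
      pᵢ∤⇒coprime pᵢ∤y = Coprimality.sym (coprime-∏ _ (λ i →
        coprime-^ (prime∤⇒coprime (pᵢ-prime i) (pᵢ∤y i)) (e (inject₁ i))))

    ¬coprime-a⇒pᵢ∣ : ∀ y → ¬ Coprime y a → ∃[ i ] pᵢ i ∣ y
    ¬coprime-a⇒pᵢ∣ y ¬y⊥a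
      with ¬∀⟶∃¬ m (λ i → ¬ pᵢ i ∣ y) (λ i → ¬? (pᵢ i ∣? y)) (¬y⊥a ∘ from (coprime-a⇔ y))
    ... | i , ¬¬pᵢ∣y = i , decidable-stable (pᵢ i ∣? y) ¬¬pᵢ∣y

    q^j⊥a : ∀ j → Coprime (q ^ j) a
    q^j⊥a j = from (coprime-a⇔ (q ^ j)) (λ i pᵢ∣q^j →
      prime∤prime (pᵢ-prime i) q-prime (pᵢ≢q i) (prime∣^⇒∣ (pᵢ-prime i) j pᵢ∣q^j))

    a≡A′*Q : a ≡ A′ P * Q P
    a≡A′*Q = sym (trans (∏-* (λ i → pᵢ i ^ (e (inject₁ i) ∸ 1)) pᵢ)
                        (∏-cong (λ i → m^[n∸1]*m≡m^n (pᵢ i) (e-pos (inject₁ i)))))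

    φ-a : φ a ≡ A′ P * φ (Q P)
    φ-a = trans (cong φ a≡A′*Q) (φ-*-sameRadical (A′ P) (Q P) (λ y y⊥Q →
      subst (Coprime y) a≡A′*Q (from (coprime-a⇔ y) (λ i pᵢ∣y →
        prime∣∧∣⇒¬coprime (pᵢ-prime i) pᵢ∣y (∣∏ pᵢ i) y⊥Q))))

    N≡a*q^[nr∸s]*q^s : ∀ s → s ≤ nr P → N P ≡ a * q ^ (nr P ∸ s) * q ^ s
    N≡a*q^[nr∸s]*q^s s s≤nr = begin
      a * q ^ nr P                 ≡⟨ cong (λ z → a * q ^ z) (sym (m∸n+n≡m s≤nr)) ⟩
      a * q ^ (nr P ∸ s + s)       ≡⟨ cong (a *_) (^-distribˡ-+-* q (nr P ∸ s) s) ⟩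
      a * (q ^ (nr P ∸ s) * q ^ s) ≡⟨ sym (*-assoc a _ _) ⟩
      a * q ^ (nr P ∸ s) * q ^ s   ∎
      where open ≡-Reasoning

    count-coprime-N : count (coprimeTo? a) (N P) ≡ q ^ nr P * φ a
    count-coprime-N =
      trans (cong (count (coprimeTo? a)) (*-comm a (q ^ nr P))) (count-coprime-multiple a (q ^ nr P))

    count-q^s∣-coprime : ∀ s → s ≤ nr P →
      count ((q ^ s ∣?_) ∩? coprimeTo? a) (N P) ≡ q ^ (nr P ∸ s) * φ a
    count-q^s∣-coprime s s≤nr = trans (cong (count _) (N≡a*q^[nr∸s]*q^s s s≤nr))
      (count-multiples-coprime (q ^ s) {{m^n≢0 q s}} a (q ^ (nr P ∸ s)) (q^j⊥a s))

    count-q^s∣ : ∀ s → s ≤ nr P → count (q ^ s ∣?_) (N P) ≡ a * q ^ (nr P ∸ s)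
    count-q^s∣ s s≤nr = trans (cong (count _) (N≡a*q^[nr∸s]*q^s s s≤nr))
      (count-divisible (q ^ s) {{m^n≢0 q s}} (a * q ^ (nr P ∸ s)))

    coprime-N⇔ : ∀ y → Coprime y (N P) ⇔ (Coprime y a × ¬ q ∣ y)
    coprime-N⇔ y = mk⇔ ⊥N⇒ ⇒⊥N
      where
      ⊥N⇒ : Coprime y (N P) → Coprime y a × ¬ q ∣ y
      ⊥N⇒ y⊥N = (λ (d∣y , d∣a) → y⊥N (d∣y , ∣m⇒∣m*n _ d∣a))
              , (λ q∣y → prime∣∧∣⇒¬coprime q-prime q∣y
                           (∣n⇒∣m*n a (m∣m^n q (e-pos (fromℕ m)))) y⊥N)
      ⇒⊥N : Coprime y a × ¬ q ∣ y → Coprime y (N P)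
      ⇒⊥N (y⊥a , q∤y) = Coprimality.sym
        (coprime-* (Coprimality.sym y⊥a) (coprime-^ (prime∤⇒coprime q-prime q∤y) (nr P)))

    φ-N : φ (N P) + q ^ (nr P ∸ 1) * φ a ≡ q ^ nr P * φ a
    φ-N = begin
      φ (N P) + q ^ (nr P ∸ 1) * φ a
        ≡⟨ cong₂ _+_
             (trans (φ≡count-coprime (N P)) (count-cong _ (coprimeTo? a ∩? ∁? (q ∣?_)) coprime-N⇔ (N P)))
             (sym (trans (count-cong _ _ q∣-swap (N P)) (count-q^s∣-coprime 1 (e-pos (fromℕ m))))) ⟩
      count (coprimeTo? a ∩? ∁? (q ∣?_)) (N P) + count (coprimeTo? a ∩? (q ∣?_)) (N P)
        ≡⟨ +-comm (count (coprimeTo? a ∩? ∁? (q ∣?_)) (N P)) _ ⟩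
      count (coprimeTo? a ∩? (q ∣?_)) (N P) + count (coprimeTo? a ∩? ∁? (q ∣?_)) (N P)
        ≡⟨ count-partition (coprimeTo? a) (q ∣?_) (N P) ⟨
      count (coprimeTo? a) (N P)
        ≡⟨ count-coprime-N ⟩
      q ^ nr P * φ a ∎
      where
      open ≡-Reasoning
      q∣-swap : ∀ y → (Coprime y a × q ∣ y) ⇔ (q ^ 1 ∣ y × Coprime y a)
      q∣-swap y = mk⇔ (λ (y⊥a , q∣y) → subst (_∣ y) (sym (*-identityʳ q)) q∣y , y⊥a)
                      (λ (q¹∣y , y⊥a) → y⊥a , subst (_∣ y) (*-identityʳ q) q¹∣y)

  module Decomposition (P : Params) (k : ℕ) (k<nr : k < nr P) where
    open Params P using (m)
    open PrimeFactors P

    s : ℕ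
    s = nr P ∸ k

    s≤nr : s ≤ nr P
    s≤nr = m∸n≤m (nr P) k

    nr∸s≡k : nr P ∸ s ≡ k
    nr∸s≡k = m∸[m∸n]≡n (<⇒≤ k<nr)

    -- Z₁ = E_{α_{k+1}} ∪ ⋯ ∪ E_{α_{n_r−1}} ∪ E_n and Z₂ = S_{β_{k,1}} ∪ ⋯ ∪ S_{β_{k,r−1}},
    -- described through the representative y of an element (see inZ⇔).
    Z₁ Z₂ : Pred ℕ 0ℓ
    Z₁ y = Coprime y a × ¬ q ^ s ∣ y
    Z₂ y = q ^ s ∣ y × ¬ Coprime y a

    Z₁? : Decidable Z₁
    Z₁? = coprimeTo? a ∩? ∁? (q ^ s ∣?_)

    Z₂? : Decidable Z₂
    Z₂? = (q ^ s ∣?_) ∩? ∁? (coprimeTo? a)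

    N≡αₖ*q^s : N P ≡ α P k * q ^ s
    N≡αₖ*q^s = trans (N≡a*q^[nr∸s]*q^s s s≤nr) (cong (λ z → a * q ^ z * q ^ s) nr∸s≡k)

    N≡β*pᵢ*q^s : ∀ i → N P ≡ β P k i * (pᵢ i * q ^ s)
    N≡β*pᵢ*q^s i = begin
      N P                       ≡⟨ N≡αₖ*q^s ⟩
      α P k * q ^ s
        ≡⟨ cong (_* q ^ s) (m/n*n≡m {{prime⇒nonZero (pᵢ-prime i)}} (∣m⇒∣m*n _ (pᵢ∣a i))) ⟨
      β P k i * pᵢ i * q ^ s    ≡⟨ *-assoc (β P k i) _ _ ⟩
      β P k i * (pᵢ i * q ^ s)  ∎
      where open ≡-Reasoning

    Z₂⇔∃pᵢq^s∣ : ∀ y → Z₂ y ⇔ (∃[ i ] pᵢ i * q ^ s ∣ y)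
    Z₂⇔∃pᵢq^s∣ y = mk⇔ Z₂⇒ ⇒Z₂
      where
      Z₂⇒ : Z₂ y → ∃[ i ] pᵢ i * q ^ s ∣ y
      Z₂⇒ (q^s∣y , ¬y⊥a) with ¬coprime-a⇒pᵢ∣ y ¬y⊥a
      ... | i , pᵢ∣y = i , coprime-∣* (Coprimality.sym (coprime-∣ (q^j⊥a s) (pᵢ∣a i))) pᵢ∣y q^s∣y
      ⇒Z₂ : ∃[ i ] pᵢ i * q ^ s ∣ y → Z₂ y
      ⇒Z₂ (i , pᵢq^s∣y) = ∣-trans (n∣m*n (pᵢ i)) pᵢq^s∣y
                         , λ y⊥a → to (coprime-a⇔ y) y⊥a i (∣-trans (m∣m*n _) pᵢq^s∣y)

    module _ {y o : ℕ} (order : IsAdditiveOrder (N P) y o) where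

      order∣⇔ : ∀ {c d} .{{_ : NonZero c}} → N P ≡ c * d → o ∣ c ⇔ d ∣ y
      order∣⇔ N≡cd = order∣factor⇔cofactor∣ (subst (λ n → IsAdditiveOrder n y o) N≡cd order)

      order∣β⇔ : ∀ i → o ∣ β P k i ⇔ pᵢ i * q ^ s ∣ y
      order∣β⇔ i = order∣⇔ {{β-nonZero}} (N≡β*pᵢ*q^s i)
        where
        β-nonZero : NonZero (β P k i)
        β-nonZero = m*n≢0⇒m≢0 (β P k i) {{subst NonZero (N≡β*pᵢ*q^s i) N-nonZero}}

      order≡α⇒Z₁ : ∀ {j} → k < j → o ≡ α P j → Z₁ y
      order≡α⇒Z₁ {j} k<j o≡αⱼ = from (coprime-a⇔ y) pᵢ∤y , q^s∤y
        where
        q^s∤y : ¬ q ^ s ∣ y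
        q^s∤y q^s∣y = <⇒≱ (^-monoʳ-< q (nonTrivial⇒n>1 q {{prime⇒nonTrivial q-prime}}) k<j)
                          (∣⇒≤ {{m^n≢0 q k}} (*-cancelˡ-∣ a αⱼ∣αₖ))
          where
          αⱼ∣αₖ : α P j ∣ α P k
          αⱼ∣αₖ = subst (_∣ α P k) o≡αⱼ (from (order∣⇔ {{a*q^j-nonZero k}} N≡αₖ*q^s) q^s∣y)
        -- If pᵢ ∣ y then the order divides N / pᵢ = u·q^{n_r} (where a = u·pᵢ), so
        -- a = u·pᵢ would divide u·q^{n_r}.
        pᵢ∤y : ∀ i → ¬ pᵢ i ∣ y
        pᵢ∤y i pᵢ∣y with pᵢ∣a i
        ... | divides u a≡u*pᵢ = prime∤prime (pᵢ-prime i) q-prime (pᵢ≢q i)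
                                   (prime∣^⇒∣ (pᵢ-prime i) (nr P) pᵢ∣q^nr)
          where
          instance
            u-nonZero : NonZero u
            u-nonZero = m*n≢0⇒m≢0 u {{subst NonZero a≡u*pᵢ a-nonZero}}
            u*q^nr-nonZero : NonZero (u * q ^ nr P)
            u*q^nr-nonZero = m*n≢0 u (q ^ nr P) {{u-nonZero}} {{m^n≢0 q (nr P)}}
          N≡u*q^nr*pᵢ : N P ≡ u * q ^ nr P * pᵢ i
          N≡u*q^nr*pᵢ = begin
            a * q ^ nr P            ≡⟨ cong (_* q ^ nr P) a≡u*pᵢ ⟩
            u * pᵢ i * q ^ nr P     ≡⟨ *-assoc u _ _ ⟩
            u * (pᵢ i * q ^ nr P)   ≡⟨ cong (u *_) (*-comm (pᵢ i) _) ⟩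
            u * (q ^ nr P * pᵢ i)   ≡⟨ *-assoc u _ _ ⟨
            u * q ^ nr P * pᵢ i     ∎
            where open ≡-Reasoning
          a∣u*q^nr : u * pᵢ i ∣ u * q ^ nr P
          a∣u*q^nr = subst (_∣ u * q ^ nr P) a≡u*pᵢ
            (∣-trans (m∣m*n (q ^ j)) (subst (_∣ u * q ^ nr P) o≡αⱼ
              (from (order∣⇔ N≡u*q^nr*pᵢ) pᵢ∣y)))
          pᵢ∣q^nr : pᵢ i ∣ q ^ nr P
          pᵢ∣q^nr = *-cancelˡ-∣ u a∣u*q^nr

      a∣order : Coprime y a → a ∣ o
      a∣order y⊥a = coprime-divisor (Coprimality.sym y⊥a)
        (subst (a ∣_) (*-comm o y) (∣-trans (m∣m*n (q ^ nr P)) (to (order o) ∣-refl)))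

      q^[nr∸t]∣order : ∀ {w t} → y ≡ w * q ^ t → ¬ q ∣ w → t ≤ nr P → q ^ (nr P ∸ t) ∣ o
      q^[nr∸t]∣order {w} {t} y≡w*q^t q∤w t≤nr =
        coprime-divisor (coprime-^ (prime∤⇒coprime q-prime q∤w) j) (subst (q ^ j ∣_) (*-comm o w) q^j∣ow)
        where
        j : ℕ
        j = nr P ∸ t
        N∣ow*q^t : a * q ^ j * q ^ t ∣ o * w * q ^ t
        N∣ow*q^t = subst₂ _∣_ (N≡a*q^[nr∸s]*q^s t t≤nr)
          (trans (cong (o *_) y≡w*q^t) (sym (*-assoc o w _))) (to (order o) ∣-refl)
        q^j∣ow : q ^ j ∣ o * w
        q^j∣ow = ∣-trans (n∣m*n a) (*-cancelʳ-∣ (q ^ t) {{m^n≢0 q t}} N∣ow*q^t)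

      -- If q^t is the exact power of q dividing y (t < s) then gcd(N, y) = q^t, so the
      -- order is a·q^{n_r − t}.
      Z₁⇒order≡α : Z₁ y → ∃[ j ] (k < j × j ≤ nr P × o ≡ α P j)
      Z₁⇒order≡α (y⊥a , q^s∤y) with ∤-power⇒exact-power q y s q^s∤y
      ... | t , t<s , divides w y≡w*q^t , q^t⁺¹∤y = nr P ∸ t , k<nr∸t , m∸n≤m (nr P) t , o≡αⱼ
        where
        t≤nr : t ≤ nr P
        t≤nr = ≤-trans (<⇒≤ t<s) s≤nr
        k<nr∸t : k < nr P ∸ t
        k<nr∸t = ∸-cancelʳ-< (subst (_< s) (sym (m∸[m∸n]≡n t≤nr)) t<s)
        q∤w : ¬ q ∣ w
        q∤w (divides v w≡v*q) =
          q^t⁺¹∤y (divides v (trans y≡w*q^t (trans (cong (_* q ^ t) w≡v*q) (*-assoc v q _))))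
        o≡αⱼ : o ≡ α P (nr P ∸ t)
        o≡αⱼ = ∣-antisym
          (from (order∣⇔ {{a*q^j-nonZero (nr P ∸ t)}} (N≡a*q^[nr∸s]*q^s t t≤nr)) (divides w y≡w*q^t))
          (coprime-∣* (Coprimality.sym (q^j⊥a (nr P ∸ t)))
                      (a∣order y⊥a) (q^[nr∸t]∣order y≡w*q^t q∤w t≤nr))

      order≡α⇔Z₁ : (∃[ j ] (k < j × j ≤ nr P × o ≡ α P j)) ⇔ Z₁ y
      order≡α⇔Z₁ = mk⇔ (λ (_ , k<j , _ , o≡αⱼ) → order≡α⇒Z₁ k<j o≡αⱼ) Z₁⇒order≡α

      order∣β⇔Z₂ : (∃[ i ] o ∣ β P k i) ⇔ Z₂ y
      order∣β⇔Z₂ = mk⇔ (λ (i , o∣β) → from (Z₂⇔∃pᵢq^s∣ y) (i , to (order∣β⇔ i) o∣β))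
                 (λ z₂ → let (i , pᵢq^s∣y) = to (Z₂⇔∃pᵢq^s∣ y) z₂
                         in i , from (order∣β⇔ i) pᵢq^s∣y)

    ∈-range⇔ : ∀ {j} → j ∈ range P k ⇔ (k < j × j < nr P)
    ∈-range⇔ {j} = mk⇔ ∈⇒ ⇒∈
      where
      ∈⇒ : j ∈ range P k → k < j × j < nr P
      ∈⇒ j∈ with ∈-map⁻ (suc k +_) j∈
      ... | t , t∈ , refl = s≤s (m≤m+n k t)
        , subst (suc k + t <_) (m+[n∸m]≡n k<nr) (+-monoʳ-< (suc k) (∈-upTo⁻ t∈))
      ⇒∈ : k < j × j < nr P → j ∈ range P k
      ⇒∈ (k<j , j<nr) = subst (_∈ range P k) (m+[n∸m]≡n k<j)
        (∈-map⁺ (suc k +_) (∈-upTo⁺ (∸-monoˡ-< j<nr k<j)))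

    E-union⇔ : ∀ {o} → (Any (λ j → o ≡ α P j) (range P k) ⊎ o ≡ N P)
                     ⇔ (∃[ j ] (k < j × j ≤ nr P × o ≡ α P j))
    E-union⇔ {o} = mk⇔ ⇒∃ ∃⇒
      where
      ⇒∃ : Any (λ j → o ≡ α P j) (range P k) ⊎ o ≡ N P → ∃[ j ] (k < j × j ≤ nr P × o ≡ α P j)
      ⇒∃ (inj₁ any) with find any
      ... | j , j∈ , o≡αⱼ = let (k<j , j<nr) = to ∈-range⇔ j∈ in j , k<j , <⇒≤ j<nr , o≡αⱼ
      ⇒∃ (inj₂ o≡N) = nr P , k<nr , ≤-refl , o≡N
      ∃⇒ : ∃[ j ] (k < j × j ≤ nr P × o ≡ α P j) → Any (λ j → o ≡ α P j) (range P k) ⊎ o ≡ N P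
      ∃⇒ (j , k<j , j≤nr , o≡αⱼ) with m≤n⇒m<n∨m≡n j≤nr
      ... | inj₁ j<nr = inj₁ (lose (from ∈-range⇔ (k<j , j<nr)) o≡αⱼ)
      ... | inj₂ refl = inj₂ o≡αⱼ

    inZ⇔ : ∀ x → InZ P k x ⇔ (Z₁ ∪ Z₂) (toℕ x)
    inZ⇔ x = mk⇔ (to (Z₁-part ⊎-⇔ Z₂-part) ∘ assocˡ) (assocʳ ∘ from (Z₁-part ⊎-⇔ Z₂-part))
      where
      order : IsAdditiveOrder (N P) (toℕ x) (ord x)
      order = ord-isAdditiveOrder x
      Z₁-part : (Any (λ j → ord x ≡ α P j) (range P k) ⊎ ord x ≡ N P) ⇔ Z₁ (toℕ x)
      Z₁-part = ⇔-trans E-union⇔ (order≡α⇔Z₁ order)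
      Z₂-part : Any (λ i → ord x ∣ β P k i) (allFin m) ⇔ Z₂ (toℕ x)
      Z₂-part = ⇔-trans Any-allFin⇔ (order∣β⇔Z₂ order)

    cardZ≡count-Z₁+count-Z₂ : cardZ P k ≡ count Z₁? (N P) + count Z₂? (N P)
    cardZ≡count-Z₁+count-Z₂ = trans (length-filter-tabulate (InZ? P k) (Z₁? ∪? Z₂?) id inZ⇔)
      (count-∪ Z₁? Z₂? (λ _ (y⊥a , _) (_ , ¬y⊥a) → ¬y⊥a y⊥a) (N P))

    common : ℕ
    common = count ((q ^ s ∣?_) ∩? coprimeTo? a) (N P)

    common≡q^k*φa : common ≡ q ^ k * φ a
    common≡q^k*φa = trans (count-q^s∣-coprime s s≤nr) (cong (λ z → q ^ z * φ a) nr∸s≡k)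

    count-coprime≡common+count-Z₁ : count (coprimeTo? a) (N P) ≡ common + count Z₁? (N P)
    count-coprime≡common+count-Z₁ = trans (count-partition (coprimeTo? a) (q ^ s ∣?_) (N P))
      (cong (_+ count Z₁? (N P)) (count-∩-comm (coprimeTo? a) (q ^ s ∣?_) (N P)))

    count-q^s∣≡common+count-Z₂ : count (q ^ s ∣?_) (N P) ≡ common + count Z₂? (N P)
    count-q^s∣≡common+count-Z₂ = count-partition (q ^ s ∣?_) (coprimeTo? a) (N P)

    cardZ-identity : cardZ P k + 2 * (q ^ k * φ a) ≡ φ (N P) + q ^ (nr P ∸ 1) * φ a + a * q ^ k
    cardZ-identity = begin
      cardZ P k + 2 * (q ^ k * φ a)
        ≡⟨ cong₂ (λ c b → c + 2 * b) cardZ≡count-Z₁+count-Z₂ (sym common≡q^k*φa) ⟩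
      count Z₁? (N P) + count Z₂? (N P) + 2 * common
        ≡⟨ regroup (count Z₁? (N P)) (count Z₂? (N P)) common ⟩
      (common + count Z₁? (N P)) + (common + count Z₂? (N P))
        ≡⟨ cong₂ _+_ count-coprime≡common+count-Z₁ count-q^s∣≡common+count-Z₂ ⟨
      count (coprimeTo? a) (N P) + count (q ^ s ∣?_) (N P)
        ≡⟨ cong₂ _+_ (trans count-coprime-N (sym φ-N)) (count-q^s∣ s s≤nr) ⟩
      φ (N P) + q ^ (nr P ∸ 1) * φ a + a * q ^ (nr P ∸ s)
        ≡⟨ cong (λ z → φ (N P) + q ^ (nr P ∸ 1) * φ a + a * q ^ z) nr∸s≡k ⟩
      φ (N P) + q ^ (nr P ∸ 1) * φ a + a * q ^ k ∎
      where
      open ≡-Reasoning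
      regroup : ∀ c₁ c₂ b → c₁ + c₂ + 2 * b ≡ (b + c₁) + (b + c₂)
      regroup = solve-∀

open import Data.Nat using (ℕ; _<_; _∸_; _^_)
import Data.Nat as ℕ
open import Data.Integer using (ℤ; +_; _+_; _*_; _-_)
open import Data.Integer.Properties using (pos-+; pos-*)
open import Data.Integer.Tactic.RingSolver using (solve-∀)
open import Relation.Binary.PropositionalEquality
  using (_≡_; refl; sym; trans; cong; cong₂; module ≡-Reasoning)
open Arithmetic using (module PrimeFactors; module Decomposition)

ℕ-identity⇒ℤ-formula : ∀ A′ φQ Q {c Φ a φa X Z} → a ≡ A′ ℕ.* Q → φa ≡ A′ ℕ.* φQ →
  c ℕ.+ 2 ℕ.* (X ℕ.* φa) ≡ Φ ℕ.+ Z ℕ.* φa ℕ.+ a ℕ.* X →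
  + c ≡ + Φ + + A′ * (+ Z * + φQ + + X * (+ Q - + 2 * + φQ))
ℕ-identity⇒ℤ-formula A′ φQ Q {c} {Φ} {X = X} {Z} refl refl eq = begin
  + c
    ≡⟨ add-sub (+ c) T ⟩
  + c + T - T
    ≡⟨ cong (_- T) (trans (sym cast-lhs) (trans (cong +_ eq) cast-rhs)) ⟩
  + Φ + + Z * F + + A′ * + Q * + X - T
    ≡⟨ regroup (+ Φ) (+ Z) (+ A′) (+ φQ) (+ Q) (+ X) ⟩
  + Φ + + A′ * (+ Z * + φQ + + X * (+ Q - + 2 * + φQ)) ∎
  where
  open ≡-Reasoning
  F T : ℤ
  F = + A′ * + φQ
  T = + 2 * (+ X * F)
  cast-F : + (A′ ℕ.* φQ) ≡ F
  cast-F = pos-* A′ φQ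
  cast-lhs : + (c ℕ.+ 2 ℕ.* (X ℕ.* (A′ ℕ.* φQ))) ≡ + c + T
  cast-lhs = trans (pos-+ c (2 ℕ.* (X ℕ.* (A′ ℕ.* φQ)))) (cong (λ z → + c + z)
    (trans (pos-* 2 (X ℕ.* (A′ ℕ.* φQ))) (cong (λ z → + 2 * z)
      (trans (pos-* X (A′ ℕ.* φQ)) (cong (λ z → + X * z) cast-F)))))
  cast-rhs : + (Φ ℕ.+ Z ℕ.* (A′ ℕ.* φQ) ℕ.+ A′ ℕ.* Q ℕ.* X) ≡ + Φ + + Z * F + + A′ * + Q * + X
  cast-rhs = trans (pos-+ (Φ ℕ.+ Z ℕ.* (A′ ℕ.* φQ)) (A′ ℕ.* Q ℕ.* X)) (cong₂ _+_
    (trans (pos-+ Φ (Z ℕ.* (A′ ℕ.* φQ))) (cong (λ z → + Φ + z)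
      (trans (pos-* Z (A′ ℕ.* φQ)) (cong (λ z → + Z * z) cast-F))))
    (trans (pos-* (A′ ℕ.* Q) X) (cong (λ z → z * + X) (pos-* A′ Q))))
  add-sub : ∀ x t → x ≡ x + t - t
  add-sub = solve-∀
  regroup : ∀ Φ Z A′ φQ Q X →
    Φ + Z * (A′ * φQ) + A′ * Q * X - + 2 * (X * (A′ * φQ)) ≡ Φ + A′ * (Z * φQ + X * (Q - + 2 * φQ))
  regroup = solve-∀

proposition3p2 : (P : Params) (k : ℕ) → k < nr P →
    + cardZ P k ≡ + φ (N P) + + A′ P * (+ (pr P ^ (nr P ∸ 1)) * + φ (Q P) + + (pr P ^ k) * (+ Q P - + 2 * + φ (Q P)))
proposition3p2 P k k<nr =
  ℕ-identity⇒ℤ-formula (A′ P) (φ (Q P)) (Q P) {Z = q ^ (nr P ∸ 1)} a≡A′*Q φ-a cardZ-identity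
  where
  open PrimeFactors P
  open Decomposition P k k<nr
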